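{- Let $I=(\{1,\dots,n\},\preceq)$ be a finite poset and let $a\in I$ be a minimal or maximal element that is junction free both in $I$ and in $S_aI$. Define the group isomorphism $s_a:\mathbb{Z}^n\to\mathbb{Z}^n$, $x\mapsto y$, by $y_a=-x_a$, $y_i=x_i+x_a$ for $i\in N_I(a)$, and $y_i=x_i$ otherwise. Then: (a) $b_I(x,y)=b_{S_aI}(s_a(x),s_a(y))$ for all $x,y\in\mathbb{Z}^n$; (b) $I$ is strongly Gram $\mathbb{Z}$-congruent with $S_aI$; (c) $S_a(S_aI)=I$.
   Context: For a finite poset $I=(\{1,\dots,n\},\preceq)$: the incidence matrix $C_I=[c_{ij}]$ has $c_{ij}=1$ iff $i\preceq j$ (else $0$); the incidence bilinear form is $b_I(x,y)=\sum_{i\preceq j}x_iy_j=xC_Iy^{tr}$. Strong Gram $\mathbb{Z}$-congruence of posets $I,J$ means $B^{tr}C_IB=C_J$ for some $B\in\mathrm{Gl}(n,\mathbb{Z})$. The neighbourhood $N_I(a)$ of $a$ is the set of elements that cover $a$ or are covered by $a$. For a minimal (resp. maximal) element $a$, the $(\min,\max)$-reflection $S_aI=(I,\preceq_\bullet)$ is defined with $\preceq_\bullet$ the reflexive–transitive closure of the relation $\preceq_\circ$ given by: for $b\in N_I(a)$, $b\preceq_\circ a$ iff $a\preceq b$ (resp. $a\preceq_\circ b$ iff $b\preceq a$); for $c,d\in I\setminus\{a\}$, $c\preceq_\circ d$ iff $c\preceq d$. A minimal element $a$ is junction free if for all $b,c\in N_I(a)$ and $d\in I\setminus\{a\}$,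 $(a\preceq b\preceq d)\wedge(a\preceq c\preceq d)$ implies $b=c$; a maximal element $a$ is junction free if $(d\preceq b\preceq a)\wedge(d\preceq c\preceq a)$ implies $b=c$. -}

module Defs where

open import Level using (0ℓ)
open import Data.Nat using (ℕ)
open import Data.Fin using (Fin; zero; suc; _≟_)
open import Data.Fin.Properties using (any?)
open import Data.Integer using (ℤ; _+_; _*_; -_; 0ℤ; 1ℤ)
open import Data.Product using (_×_; _,_; ∃; ∃-syntax)
open import Data.Sum using (_⊎_)
open import Data.Bool using (if_then_else_)
open import Relation.Nullary using (¬_; Dec; yes; no; does)
open import Relation.Nullary.Decidable using (_×-dec_; ¬?)
open import Relation.Binary using (Rel; Decidable; IsPartialOrder)
open import Relation.Binary.PropositionalEquality using (_≡_; _≢_)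
open import Relation.Binary.Construct.Closure.ReflexiveTransitive using (Star)

record FinPoset (n : ℕ) : Set₁ where
  field
    _≼_            : Rel (Fin n) 0ℓ
    isPartialOrder : IsPartialOrder _≡_ _≼_
    _≼?_           : Decidable _≼_

module _ {n : ℕ} (R : Rel (Fin n) 0ℓ) where

  Lt : Rel (Fin n) 0ℓ
  Lt i j = R i j × i ≢ j

  Covers : Rel (Fin n) 0ℓ
  Covers a b = Lt a b × ¬ (∃[ c ] (Lt a c × Lt c b))

  Nbhd : Fin n → Fin n → Set
  Nbhd a b = Covers a b ⊎ Covers b a

  IsMinimal : Fin n → Set
  IsMinimal a = ∀ b → R b a → b ≡ a

  IsMaximal : Fin n → Set
  IsMaximal a = ∀ b → R a b → b ≡ a

data Side : Set where
  min max : Side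

flipSide : Side → Side
flipSide min = max
flipSide max = min

module _ {n : ℕ} where

  Extremal : Side → Rel (Fin n) 0ℓ → Fin n → Set
  Extremal min R a = IsMinimal R a
  Extremal max R a = IsMaximal R a

  JunctionFree : Side → Rel (Fin n) 0ℓ → Fin n → Set
  JunctionFree min R a = ∀ b c d → Nbhd R a b → Nbhd R a c → d ≢ a →
    R a b → R b d → R a c → R c d → b ≡ c
  JunctionFree max R a = ∀ b c d → Nbhd R a b → Nbhd R a c → d ≢ a →
    R d b → R b a → R d c → R c a → b ≡ c

  ReflGen : Side → Fin n → Rel (Fin n) 0ℓ → Rel (Fin n) 0ℓ
  ReflGen min a R c d = (Nbhd R a c × d ≡ a × R a c) ⊎ (c ≢ a × d ≢ a × R c d)
  ReflGen max a R c d = (c ≡ a × Nbhd R a d × R d a) ⊎ (c ≢ a × d ≢ a × R c d)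

  -- ≼• : reflexive–transitive closure of ≼∘ ; the order of S_a I
  Refl : Side → Fin n → Rel (Fin n) 0ℓ → Rel (Fin n) 0ℓ
  Refl s a R = Star (ReflGen s a R)

∑ : {n : ℕ} → (Fin n → ℤ) → ℤ
∑ {ℕ.zero}  f = 0ℤ
∑ {ℕ.suc n} f = f zero + ∑ (λ i → f (suc i))

Matrix : ℕ → Set
Matrix n = Fin n → Fin n → ℤ

_⊗_ : {n : ℕ} → Matrix n → Matrix n → Matrix n
(A ⊗ B) i j = ∑ (λ k → A i k * B k j)

transpose : {n : ℕ} → Matrix n → Matrix n
transpose A i j = A j i

idMat : {n : ℕ} → Matrix n
idMat i j = if does (i ≟ j) then 1ℤ else 0ℤ

_≐_ : {n : ℕ} → Matrix n → Matrix n → Set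
A ≐ B = ∀ i j → A i j ≡ B i j

InGl : {n : ℕ} → Matrix n → Set
InGl {n} B = ∃[ B' ] ((B ⊗ B') ≐ idMat × (B' ⊗ B) ≐ idMat)

incMat : {n : ℕ} {R : Rel (Fin n) 0ℓ} → Decidable R → Matrix n
incMat d i j = if does (d i j) then 1ℤ else 0ℤ

bform : {n : ℕ} {R : Rel (Fin n) 0ℓ} → Decidable R → (Fin n → ℤ) → (Fin n → ℤ) → ℤ
bform d x y = ∑ (λ i → ∑ (λ j → x i * (incMat d i j * y j)))

StronglyGramCongruent : {n : ℕ} → Matrix n → Matrix n → Set
StronglyGramCongruent C C' = ∃[ B ] (InGl B × (transpose B ⊗ (C ⊗ B)) ≐ C')

module _ {n : ℕ} (I : FinPoset n) where
  open FinPoset I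

  lt? : Decidable (Lt _≼_)
  lt? i j = (i ≼? j) ×-dec ¬? (i ≟ j)

  covers? : Decidable (Covers _≼_)
  covers? a b = lt? a b ×-dec ¬? (any? (λ c → lt? a c ×-dec lt? c b))

  nbhd? : (a b : Fin n) → Dec (Nbhd _≼_ a b)
  nbhd? a b with covers? a b | covers? b a
  ... | yes p | _     = yes (Data.Sum.inj₁ p)
  ... | no _  | yes q = yes (Data.Sum.inj₂ q)
  ... | no p  | no q  = no λ { (Data.Sum.inj₁ r) → p r ; (Data.Sum.inj₂ r) → q r }

  sMap : Fin n → (Fin n → ℤ) → (Fin n → ℤ)
  sMap a x i =
    if does (i ≟ a) then - x a
    else (if does (nbhd? a i) then x i + x a else x i)

module Submission where

-- Let M be the matrix of s_a, with rows s_a(e_k); s_a is an involution. Everything follows from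
-- the identity C_I = M C_{S_a I} Mᵗ: part (a) is the change of variables x ↦ x M, and part (b)
-- takes B = Mᵗ. The identity is checked entrywise for a minimal a. Away from a the two orders
-- agree. The entries in row and column a count the neighbours of a lying below, resp. above, a
-- given element: junction freeness of I, resp. of S_a I, allows at most one, and below every
-- element above a lies a cover of a. Part (c) is a direct comparison of the generators.

open import Defs
open import Level using (0ℓ)
open import Data.Bool using (true; false; if_then_else_)
open import Data.Empty using (⊥-elim)
open import Data.Fin using (Fin; zero; suc; _≟_)
open import Data.Fin.Induction using (po-wellFounded)
open import Data.Fin.Properties using (any?; suc-injective)
open import Data.Integer using (ℤ; _+_; _*_; -_; 0ℤ; 1ℤ)
open import Data.Integer.Properties
  using (+-identityˡ; +-identityʳ; +-inverseˡ; *-zeroˡ; *-zeroʳ; *-identityʳ; *-comm; *-assoc;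
         *-distribˡ-+; *-distribʳ-+; neg-distrib-+; neg-distribˡ-*; neg-distribʳ-*; neg-involutive)
open import Data.Integer.Tactic.RingSolver using (solve-∀)
open import Data.Nat using (ℕ)
open import Data.Product using (_×_; _,_; ∃-syntax; proj₁; proj₂)
open import Data.Sum using (inj₁; inj₂)
open import Function.Base using (_∘_; flip; id)
open import Function.Bundles using (_⇔_; mk⇔; Equivalence)
open import Function.Properties.Equivalence using () renaming (sym to ⇔-sym; trans to ⇔-trans)
open import Induction.WellFounded using (Acc; acc)
open import Relation.Binary using (Rel; _⇒_; IsPartialOrder; Decidable)
open import Relation.Binary.Construct.Closure.ReflexiveTransitive using (ε; _◅_; _◅◅_; gmap; reverse)
import Relation.Binary.Construct.Flip.EqAndOrd as Flip
open import Relation.Binary.PropositionalEquality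
  using (_≡_; _≢_; _≗_; refl; sym; trans; cong; cong₂; subst; module ≡-Reasoning)
open import Relation.Nullary using (¬_; Dec; yes; no; does; _because_; _×-dec_)
open import Relation.Nullary.Decidable using (dec-true; dec-false; does-⇔; toSum; map′)

private variable
  n : ℕ
  R R′ : Rel (Fin n) 0ℓ

∑-cong : {f g : Fin n → ℤ} → f ≗ g → ∑ f ≡ ∑ g
∑-cong {ℕ.zero}  f≗g = refl
∑-cong {ℕ.suc n} f≗g = cong₂ _+_ (f≗g zero) (∑-cong (f≗g ∘ suc))

∑-zero : {f : Fin n → ℤ} → (∀ i → f i ≡ 0ℤ) → ∑ f ≡ 0ℤ
∑-zero {ℕ.zero}  f≡0 = refl
∑-zero {ℕ.suc n} f≡0 = cong₂ _+_ (f≡0 zero) (∑-zero (f≡0 ∘ suc))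

∑-+ : (f g : Fin n → ℤ) → ∑ (λ i → f i + g i) ≡ ∑ f + ∑ g
∑-+ {ℕ.zero}  f g = refl
∑-+ {ℕ.suc n} f g =
  trans (cong (f zero + g zero +_) (∑-+ (f ∘ suc) (g ∘ suc)))
        (interchange (f zero) (g zero) (∑ (f ∘ suc)) (∑ (g ∘ suc)))
  where
  interchange : ∀ a b c d → a + b + (c + d) ≡ a + c + (b + d)
  interchange = solve-∀

∑-neg : (f : Fin n → ℤ) → ∑ (λ i → - f i) ≡ - ∑ f
∑-neg {ℕ.zero}  f = refl
∑-neg {ℕ.suc n} f =
  trans (cong (- f zero +_) (∑-neg (f ∘ suc))) (sym (neg-distrib-+ (f zero) _))

∑-*ˡ : (c : ℤ) (f : Fin n → ℤ) → ∑ (λ i → c * f i) ≡ c * ∑ f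
∑-*ˡ {ℕ.zero}  c f = sym (*-zeroʳ c)
∑-*ˡ {ℕ.suc n} c f =
  trans (cong (c * f zero +_) (∑-*ˡ c (f ∘ suc))) (sym (*-distribˡ-+ c (f zero) _))

∑-*ʳ : (f : Fin n → ℤ) (c : ℤ) → ∑ (λ i → f i * c) ≡ ∑ f * c
∑-*ʳ f c = trans (∑-cong (λ i → *-comm (f i) c)) (trans (∑-*ˡ c f) (*-comm c (∑ f)))

∑-swap : ∀ {m} (f : Fin m → Fin n → ℤ) →
         ∑ (λ i → ∑ (λ j → f i j)) ≡ ∑ (λ j → ∑ (λ i → f i j))
∑-swap {n} {m = ℕ.zero}  f = sym (∑-zero {n} (λ _ → refl))
∑-swap {m = ℕ.suc m} f =
  trans (cong (∑ (f zero) +_) (∑-swap (f ∘ suc))) (sym (∑-+ (f zero) _))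

∑-single : {f : Fin n → ℤ} (i : Fin n) → (∀ j → j ≢ i → f j ≡ 0ℤ) → ∑ f ≡ f i
∑-single {ℕ.suc n} {f} zero    f≡0 =
  trans (cong (f zero +_) (∑-zero (λ j → f≡0 (suc j) (λ ())))) (+-identityʳ _)
∑-single {ℕ.suc n} {f} (suc i) f≡0 =
  trans (cong₂ _+_ (f≡0 zero (λ ())) (∑-single i (λ j j≢i → f≡0 (suc j) (j≢i ∘ suc-injective))))
        (+-identityˡ _)

ind : {P : Set} → Dec P → ℤ
ind p = if does p then 1ℤ else 0ℤ

ind-yes : {P : Set} (p : Dec P) → P → ind p ≡ 1ℤ
ind-yes p x = cong (if_then 1ℤ else 0ℤ) (dec-true p x)

ind-no : {P : Set} (p : Dec P) → ¬ P → ind p ≡ 0ℤ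
ind-no p ¬x = cong (if_then 1ℤ else 0ℤ) (dec-false p ¬x)

ind-cong : {P Q : Set} (p : Dec P) (q : Dec Q) → P ⇔ Q → ind p ≡ ind q
ind-cong p q P⇔Q = cong (if_then 1ℤ else 0ℤ) (does-⇔ P⇔Q p q)

ind-× : {P Q : Set} (p : Dec P) (q : Dec Q) → ind p * ind q ≡ ind (p ×-dec q)
ind-× (true  because _) (true  because _) = refl
ind-× (true  because _) (false because _) = refl
ind-× (false because _) q                 = *-zeroˡ (ind q)

∑-ind : {P : Fin n → Set} (p : ∀ i → Dec (P i)) → (∀ {i j} → P i → P j → i ≡ j) →
        ∑ (λ i → ind (p i)) ≡ ind (any? p)
∑-ind p unique with any? p
... | yes (i , Pi) = trans (∑-single i (λ j j≢i → ind-no (p j) (λ Pj → j≢i (unique Pj Pi))))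
                           (ind-yes (p i) Pi)
... | no ¬∃P       = ∑-zero (λ j → ind-no (p j) (λ Pj → ¬∃P (j , Pj)))

∑-ind-× : {P Q : Fin n → Set} {R : Set} (p : ∀ i → Dec (P i)) (q : ∀ i → Dec (Q i)) (r : Dec R) →
          (∀ {i j} → P i × Q i → P j × Q j → i ≡ j) → R ⇔ (∃[ i ] (P i × Q i)) →
          ∑ (λ i → ind (p i) * ind (q i)) ≡ ind r
∑-ind-× p q r unique R⇔∃ = begin
  ∑ (λ i → ind (p i) * ind (q i))  ≡⟨ ∑-cong (λ i → ind-× (p i) (q i)) ⟩
  ∑ (λ i → ind (p i ×-dec q i))    ≡⟨ ∑-ind (λ i → p i ×-dec q i) unique ⟩
  ind (any? (λ i → p i ×-dec q i)) ≡⟨ ind-cong (any? (λ i → p i ×-dec q i)) r (⇔-sym R⇔∃) ⟩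
  ind r                            ∎
  where open ≡-Reasoning

idMat-sym : (i j : Fin n) → idMat i j ≡ idMat j i
idMat-sym i j = ind-cong (i ≟ j) (j ≟ i) (mk⇔ sym sym)

∑-idMat-col : (x : Fin n → ℤ) (i : Fin n) → ∑ (λ k → x k * idMat k i) ≡ x i
∑-idMat-col x i =
  trans (∑-single i (λ k k≢i → trans (cong (x k *_) (ind-no (k ≟ i) k≢i)) (*-zeroʳ (x k))))
        (trans (cong (x i *_) (ind-yes (i ≟ i) refl)) (*-identityʳ (x i)))

∑-idMat-row : (x : Fin n → ℤ) (i : Fin n) → ∑ (λ k → x k * idMat i k) ≡ x i
∑-idMat-row x i = trans (∑-cong (λ k → cong (x k *_) (idMat-sym i k))) (∑-idMat-col x i)

-- bform d is bf (incMat d) by definition; bf also admits transposed matrices.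
bf : Matrix n → (Fin n → ℤ) → (Fin n → ℤ) → ℤ
bf C x y = ∑ (λ i → ∑ (λ j → x i * (C i j * y j)))

_*ᵥ_ : (Fin n → ℤ) → Matrix n → (Fin n → ℤ)
(x *ᵥ M) j = ∑ (λ k → x k * M k j)

bf-cong : (C : Matrix n) {x x′ y y′ : Fin n → ℤ} → x ≗ x′ → y ≗ y′ → bf C x y ≡ bf C x′ y′
bf-cong C x≗x′ y≗y′ =
  ∑-cong (λ i → ∑-cong (λ j → cong₂ (λ u v → u * (C i j * v)) (x≗x′ i) (y≗y′ j)))

bf-rows : (C : Matrix n) (x y : Fin n → ℤ) → bf C x y ≡ ∑ (λ i → x i * ∑ (λ j → C i j * y j))
bf-rows C x y = ∑-cong (λ i → ∑-*ˡ (x i) (λ j → C i j * y j))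

bf-transpose : (C : Matrix n) (x y : Fin n → ℤ) → bf (transpose C) x y ≡ bf C y x
bf-transpose C x y =
  trans (∑-swap (λ i j → x i * (C j i * y j)))
        (∑-cong (λ j → ∑-cong (λ i → reorder (x i) (C j i) (y j))))
  where
  reorder : ∀ a b c → a * (b * c) ≡ c * (b * a)
  reorder = solve-∀

bf-basisˡ : (C : Matrix n) (k : Fin n) (y : Fin n → ℤ) →
            bf C (idMat k) y ≡ ∑ (λ j → C k j * y j)
bf-basisˡ C k y =
  trans (bf-rows C (idMat k) y)
        (trans (∑-cong (λ i → *-comm (idMat k i) _)) (∑-idMat-row (λ i → ∑ (λ j → C i j * y j)) k))

bf-basisʳ : (C : Matrix n) (x : Fin n → ℤ) (l : Fin n) →
            bf C x (idMat l) ≡ ∑ (λ i → x i * C i l)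
bf-basisʳ C x l = trans (bf-rows C x (idMat l)) (∑-cong (λ i → cong (x i *_) (∑-idMat-row (C i) l)))

bf-basis : (C : Matrix n) (k l : Fin n) → bf C (idMat k) (idMat l) ≡ C k l
bf-basis C k l = trans (bf-basisˡ C k (idMat l)) (∑-idMat-row (C k) l)

bf-*ᵥˡ : (C M : Matrix n) (x y : Fin n → ℤ) → bf C (x *ᵥ M) y ≡ ∑ (λ k → x k * bf C (M k) y)
bf-*ᵥˡ C M x y = begin
  bf C (x *ᵥ M) y                           ≡⟨ bf-rows C (x *ᵥ M) y ⟩
  ∑ (λ i → (x *ᵥ M) i * w i)                ≡⟨ ∑-cong (λ i → ∑-*ʳ (λ k → x k * M k i) (w i)) ⟨
  ∑ (λ i → ∑ (λ k → x k * M k i * w i))     ≡⟨ ∑-swap (λ i k → x k * M k i * w i) ⟩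
  ∑ (λ k → ∑ (λ i → x k * M k i * w i))     ≡⟨ ∑-cong (λ k → ∑-cong (λ i → *-assoc (x k) (M k i) (w i))) ⟩
  ∑ (λ k → ∑ (λ i → x k * (M k i * w i)))   ≡⟨ ∑-cong (λ k → ∑-*ˡ (x k) (λ i → M k i * w i)) ⟩
  ∑ (λ k → x k * ∑ (λ i → M k i * w i))     ≡⟨ ∑-cong (λ k → cong (x k *_) (bf-rows C (M k) y)) ⟨
  ∑ (λ k → x k * bf C (M k) y)              ∎
  where
  open ≡-Reasoning
  w : Fin _ → ℤ
  w i = ∑ (λ j → C i j * y j)

bf-*ᵥʳ : (C M : Matrix n) (x y : Fin n → ℤ) → bf C x (y *ᵥ M) ≡ ∑ (λ l → y l * bf C x (M l))
bf-*ᵥʳ C M x y = begin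
  bf C x (y *ᵥ M)                          ≡⟨ bf-transpose C (y *ᵥ M) x ⟨
  bf (transpose C) (y *ᵥ M) x              ≡⟨ bf-*ᵥˡ (transpose C) M y x ⟩
  ∑ (λ l → y l * bf (transpose C) (M l) x) ≡⟨ ∑-cong (λ l → cong (y l *_) (bf-transpose C (M l) x)) ⟩
  ∑ (λ l → y l * bf C x (M l))             ∎
  where open ≡-Reasoning

bf-*ᵥ : (C M G : Matrix n) → (∀ k l → G k l ≡ bf C (M k) (M l)) →
        ∀ x y → bf G x y ≡ bf C (x *ᵥ M) (y *ᵥ M)
bf-*ᵥ C M G G≡MCMᵗ x y = sym (begin
  bf C (x *ᵥ M) (y *ᵥ M)                              ≡⟨ bf-*ᵥˡ C M x (y *ᵥ M) ⟩
  ∑ (λ k → x k * bf C (M k) (y *ᵥ M))                 ≡⟨ ∑-cong (λ k → cong (x k *_) (bf-*ᵥʳ C M (M k) y)) ⟩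
  ∑ (λ k → x k * ∑ (λ l → y l * bf C (M k) (M l)))    ≡⟨ ∑-cong (λ k → ∑-*ˡ (x k) (λ l → y l * bf C (M k) (M l))) ⟨
  ∑ (λ k → ∑ (λ l → x k * (y l * bf C (M k) (M l))))  ≡⟨ ∑-cong (λ k → ∑-cong (λ l → cong (x k *_) (entry k l))) ⟩
  bf G x y                                            ∎)
  where
  open ≡-Reasoning
  entry : ∀ k l → y l * bf C (M k) (M l) ≡ G k l * y l
  entry k l = trans (*-comm (y l) _) (cong (_* y l) (sym (G≡MCMᵗ k l)))

nbhd-irrefl : {a : Fin n} → ¬ Nbhd R a a
nbhd-irrefl (inj₁ ((_ , a≢a) , _)) = a≢a refl
nbhd-irrefl (inj₂ ((_ , a≢a) , _)) = a≢a refl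

module _ (I : FinPoset n) (a : Fin n) where
  open FinPoset I

  data Position (i : Fin n) : Set where
    at-a    : i ≡ a → Position i
    in-nbhd : i ≢ a → Nbhd _≼_ a i → Position i
    outside : i ≢ a → ¬ Nbhd _≼_ a i → Position i

  position : (i : Fin n) → Position i
  position i with i ≟ a | nbhd? I a i
  ... | yes i≡a | _      = at-a i≡a
  ... | no i≢a | yes i∈N = in-nbhd i≢a i∈N
  ... | no i≢a | no i∉N  = outside i≢a i∉N

  sMatrix : Matrix n
  sMatrix k = sMap I a (idMat k)

  sMap-a : (x : Fin n → ℤ) → sMap I a x a ≡ - x a
  sMap-a x = cong (if_then - x a else (if does (nbhd? I a a) then x a + x a else x a))
                 (dec-true (a ≟ a) refl)

  sMap-nbhd : (x : Fin n → ℤ) {i : Fin n} → i ≢ a → Nbhd _≼_ a i → sMap I a x i ≡ x i + x a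
  sMap-nbhd x {i} i≢a i∈N =
    trans (cong (if_then - x a else (if does (nbhd? I a i) then x i + x a else x i))
                (dec-false (i ≟ a) i≢a))
          (cong (if_then x i + x a else x i) (dec-true (nbhd? I a i) i∈N))

  sMap-outside : (x : Fin n → ℤ) {i : Fin n} → i ≢ a → ¬ Nbhd _≼_ a i → sMap I a x i ≡ x i
  sMap-outside x {i} i≢a i∉N =
    trans (cong (if_then - x a else (if does (nbhd? I a i) then x i + x a else x i))
                (dec-false (i ≟ a) i≢a))
          (cong (if_then x i + x a else x i) (dec-false (nbhd? I a i) i∉N))

  sMap-*ᵥ : (x : Fin n → ℤ) → sMap I a x ≗ x *ᵥ sMatrix
  sMap-*ᵥ x i with position i
  ... | at-a refl = begin
    sMap I a x a                         ≡⟨ sMap-a x ⟩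
    - x a                                ≡⟨ cong -_ (∑-idMat-col x a) ⟨
    - ∑ (λ k → x k * idMat k a)          ≡⟨ ∑-neg (λ k → x k * idMat k a) ⟨
    ∑ (λ k → - (x k * idMat k a))        ≡⟨ ∑-cong (λ k → neg-distribʳ-* (x k) (idMat k a)) ⟩
    ∑ (λ k → x k * - idMat k a)          ≡⟨ ∑-cong (λ k → cong (x k *_) (sMap-a (idMat k))) ⟨
    ∑ (λ k → x k * sMatrix k a)          ∎
    where open ≡-Reasoning
  ... | in-nbhd i≢a i∈N = begin
    sMap I a x i                                          ≡⟨ sMap-nbhd x i≢a i∈N ⟩
    x i + x a                                             ≡⟨ cong₂ _+_ (∑-idMat-col x i) (∑-idMat-col x a) ⟨
    ∑ (λ k → x k * idMat k i) + ∑ (λ k → x k * idMat k a) ≡⟨ ∑-+ (λ k → x k * idMat k i) (λ k → x k * idMat k a) ⟨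
    ∑ (λ k → x k * idMat k i + x k * idMat k a)           ≡⟨ ∑-cong (λ k → *-distribˡ-+ (x k) (idMat k i) (idMat k a)) ⟨
    ∑ (λ k → x k * (idMat k i + idMat k a))               ≡⟨ ∑-cong (λ k → cong (x k *_) (sMap-nbhd (idMat k) i≢a i∈N)) ⟨
    ∑ (λ k → x k * sMatrix k i)                           ∎
    where open ≡-Reasoning
  ... | outside i≢a i∉N = begin
    sMap I a x i                 ≡⟨ sMap-outside x i≢a i∉N ⟩
    x i                          ≡⟨ ∑-idMat-col x i ⟨
    ∑ (λ k → x k * idMat k i)    ≡⟨ ∑-cong (λ k → cong (x k *_) (sMap-outside (idMat k) i≢a i∉N)) ⟨
    ∑ (λ k → x k * sMatrix k i)  ∎
    where open ≡-Reasoning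

  sMap-involutive : (x : Fin n → ℤ) → sMap I a (sMap I a x) ≗ x
  sMap-involutive x i with position i
  ... | at-a refl = trans (sMap-a (sMap I a x)) (trans (cong -_ (sMap-a x)) (neg-involutive (x a)))
  ... | in-nbhd i≢a i∈N =
    trans (sMap-nbhd (sMap I a x) i≢a i∈N)
          (trans (cong₂ _+_ (sMap-nbhd x i≢a i∈N) (sMap-a x)) (cancel (x i) (x a)))
    where
    cancel : ∀ u v → u + v + - v ≡ u
    cancel = solve-∀
  ... | outside i≢a i∉N =
    trans (sMap-outside (sMap I a x) i≢a i∉N) (sMap-outside x i≢a i∉N)

  sMatrix-≢ : {k : Fin n} → k ≢ a → sMatrix k ≗ idMat k
  sMatrix-≢ {k} k≢a i with position i
  ... | at-a refl = trans (sMap-a (idMat k)) (trans (cong -_ eₖa≡0) (sym eₖa≡0))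
    where
    eₖa≡0 : idMat k a ≡ 0ℤ
    eₖa≡0 = ind-no (k ≟ a) k≢a
  ... | in-nbhd i≢a i∈N =
    trans (sMap-nbhd (idMat k) i≢a i∈N)
          (trans (cong (idMat k i +_) (ind-no (k ≟ a) k≢a)) (+-identityʳ _))
  ... | outside i≢a i∉N = sMap-outside (idMat k) i≢a i∉N

  sMatrix-a : (i : Fin n) → sMatrix a i ≡ - idMat a i + ind (nbhd? I a i)
  sMatrix-a i with position i
  ... | at-a refl =
    trans (sMap-a (idMat a)) (sym (trans (cong (- idMat a a +_) (ind-no (nbhd? I a a) (nbhd-irrefl {R = _≼_})))
                                         (+-identityʳ _)))
  ... | in-nbhd i≢a i∈N = begin
    sMatrix a i                      ≡⟨ sMap-nbhd (idMat a) i≢a i∈N ⟩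
    idMat a i + idMat a a            ≡⟨ cong₂ _+_ eₐi≡0 (ind-yes (a ≟ a) refl) ⟩
    0ℤ + 1ℤ                          ≡⟨ cong₂ _+_ (cong -_ eₐi≡0) (ind-yes (nbhd? I a i) i∈N) ⟨
    - idMat a i + ind (nbhd? I a i)  ∎
    where
    open ≡-Reasoning
    eₐi≡0 : idMat a i ≡ 0ℤ
    eₐi≡0 = ind-no (a ≟ i) (i≢a ∘ sym)
  ... | outside i≢a i∉N = begin
    sMatrix a i                      ≡⟨ sMap-outside (idMat a) i≢a i∉N ⟩
    idMat a i                        ≡⟨ eₐi≡0 ⟩
    0ℤ                               ≡⟨ cong₂ _+_ (cong -_ eₐi≡0) (ind-no (nbhd? I a i) i∉N) ⟨
    - idMat a i + ind (nbhd? I a i)  ∎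
    where
    open ≡-Reasoning
    eₐi≡0 : idMat a i ≡ 0ℤ
    eₐi≡0 = ind-no (a ≟ i) (i≢a ∘ sym)

  ∑-sMatrix-a : (w : Fin n → ℤ) → ∑ (λ i → sMatrix a i * w i) ≡ - w a + ∑ (λ i → ind (nbhd? I a i) * w i)
  ∑-sMatrix-a w = begin
    ∑ (λ i → sMatrix a i * w i)                                   ≡⟨ ∑-cong (λ i → cong (_* w i) (sMatrix-a i)) ⟩
    ∑ (λ i → (- idMat a i + ind (nbhd? I a i)) * w i)             ≡⟨ ∑-cong (λ i → *-distribʳ-+ (w i) (- idMat a i) _) ⟩
    ∑ (λ i → - idMat a i * w i + ind (nbhd? I a i) * w i)         ≡⟨ ∑-+ (λ i → - idMat a i * w i) _ ⟩
    ∑ (λ i → - idMat a i * w i) + ∑ (λ i → ind (nbhd? I a i) * w i)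
      ≡⟨ cong (_+ ∑ (λ i → ind (nbhd? I a i) * w i)) first ⟩
    - w a + ∑ (λ i → ind (nbhd? I a i) * w i)                     ∎
    where
    open ≡-Reasoning
    first : ∑ (λ i → - idMat a i * w i) ≡ - w a
    first = begin
      ∑ (λ i → - idMat a i * w i)   ≡⟨ ∑-cong (λ i → trans (sym (neg-distribˡ-* (idMat a i) (w i))) (cong -_ (*-comm (idMat a i) (w i)))) ⟩
      ∑ (λ i → - (w i * idMat a i)) ≡⟨ ∑-neg (λ i → w i * idMat a i) ⟩
      - ∑ (λ i → w i * idMat a i)   ≡⟨ cong -_ (∑-idMat-row w a) ⟩
      - w a                         ∎

  sMatrixᵀ-involutive : (transpose sMatrix ⊗ transpose sMatrix) ≐ idMat
  sMatrixᵀ-involutive i j = begin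
    ∑ (λ k → sMatrix k i * sMatrix j k)  ≡⟨ ∑-cong (λ k → *-comm (sMatrix k i) (sMatrix j k)) ⟩
    (sMatrix j *ᵥ sMatrix) i             ≡⟨ sMap-*ᵥ (sMatrix j) i ⟨
    sMap I a (sMap I a (idMat j)) i      ≡⟨ sMap-involutive (idMat j) i ⟩
    idMat j i                            ≡⟨ idMat-sym j i ⟩
    idMat i j                            ∎
    where open ≡-Reasoning

covers-flip : {a b : Fin n} → Covers R a b → Covers (flip R) b a
covers-flip ((Rab , a≢b) , no-between) =
  (Rab , a≢b ∘ sym) ,
  λ { (c , (Rcb , b≢c) , (Rac , c≢a)) → no-between (c , (Rac , c≢a ∘ sym) , (Rcb , b≢c ∘ sym)) }

nbhd-flip : {a b : Fin n} → Nbhd R a b → Nbhd (flip R) a b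
nbhd-flip (inj₁ a⋖b) = inj₂ (covers-flip a⋖b)
nbhd-flip (inj₂ b⋖a) = inj₁ (covers-flip b⋖a)

covers-resp : R ⇒ R′ → R′ ⇒ R → {a b : Fin n} → Covers R a b → Covers R′ a b
covers-resp f g ((Rab , a≢b) , no-between) =
  (f Rab , a≢b) ,
  λ { (c , (R′ac , a≢c) , (R′cb , c≢b)) → no-between (c , (g R′ac , a≢c) , (g R′cb , c≢b)) }

nbhd-resp : R ⇒ R′ → R′ ⇒ R → {a b : Fin n} → Nbhd R a b → Nbhd R′ a b
nbhd-resp f g (inj₁ a⋖b) = inj₁ (covers-resp f g a⋖b)
nbhd-resp f g (inj₂ b⋖a) = inj₂ (covers-resp f g b⋖a)

refl-resp : (s : Side) (a : Fin n) → R ⇒ R′ → R′ ⇒ R → Refl s a R ⇒ Refl s a R′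
refl-resp min a f g = gmap id λ
  { (inj₁ (c∈N , d≡a , Rac))   → inj₁ (nbhd-resp f g c∈N , d≡a , f Rac)
  ; (inj₂ (c≢a , d≢a , Rcd))   → inj₂ (c≢a , d≢a , f Rcd) }
refl-resp max a f g = gmap id λ
  { (inj₁ (c≡a , d∈N , Rda))   → inj₁ (c≡a , nbhd-resp f g d∈N , f Rda)
  ; (inj₂ (c≢a , d≢a , Rcd))   → inj₂ (c≢a , d≢a , f Rcd) }

junctionFree-resp : (s : Side) {a : Fin n} → R ⇒ R′ → R′ ⇒ R → JunctionFree s R a → JunctionFree s R′ a
junctionFree-resp min f g jf b c d b∈N c∈N d≢a p q r t =
  jf b c d (nbhd-resp g f b∈N) (nbhd-resp g f c∈N) d≢a (g p) (g q) (g r) (g t)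
junctionFree-resp max f g jf b c d b∈N c∈N d≢a p q r t =
  jf b c d (nbhd-resp g f b∈N) (nbhd-resp g f c∈N) d≢a (g p) (g q) (g r) (g t)

junctionFree-flip : (s : Side) {a : Fin n} → JunctionFree s R a → JunctionFree (flipSide s) (flip R) a
junctionFree-flip min jf b c d b∈N c∈N d≢a p q r t = jf b c d (nbhd-flip b∈N) (nbhd-flip c∈N) d≢a q p t r
junctionFree-flip max jf b c d b∈N c∈N d≢a p q r t = jf b c d (nbhd-flip b∈N) (nbhd-flip c∈N) d≢a q p t r

refl-max⇔refl-min-flip : {a x y : Fin n} → Refl max a R x y ⇔ Refl min a (flip R) y x
refl-max⇔refl-min-flip {a = a} = mk⇔ (reverse max⇒min) (reverse min⇒max)
  where
  max⇒min : ∀ {c d} → ReflGen max a R c d → ReflGen min a (flip R) d c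
  max⇒min (inj₁ (c≡a , d∈N , Rda)) = inj₁ (nbhd-flip d∈N , c≡a , Rda)
  max⇒min (inj₂ (c≢a , d≢a , Rcd)) = inj₂ (d≢a , c≢a , Rcd)
  min⇒max : ∀ {c d} → ReflGen min a (flip R) c d → ReflGen max a R d c
  min⇒max (inj₁ (c∈N , d≡a , Rca)) = inj₁ (d≡a , nbhd-flip c∈N , Rca)
  min⇒max (inj₂ (c≢a , d≢a , Rdc)) = inj₂ (d≢a , c≢a , Rdc)

opposite : FinPoset n → FinPoset n
opposite I = record
  { _≼_            = flip _≼_
  ; isPartialOrder = Flip.isPartialOrder isPartialOrder
  ; _≼?_           = flip _≼?_
  }
  where open FinPoset I

sMap-opposite : (I : FinPoset n) (a : Fin n) (x : Fin n → ℤ) → sMap (opposite I) a x ≗ sMap I a x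
sMap-opposite I a x j =
  cong (λ b → if does (j ≟ a) then - x a else (if b then x j + x a else x j))
       (does-⇔ (mk⇔ nbhd-flip nbhd-flip) (nbhd? (opposite I) a j) (nbhd? I a j))

module MinimalReflection (I : FinPoset n) (a : Fin n) (a-min : IsMinimal (FinPoset._≼_ I) a) where
  open FinPoset I
  open IsPartialOrder isPartialOrder using (antisym) renaming (refl to ≼-refl; trans to ≼-trans)

  _≼•_ : Rel (Fin n) 0ℓ
  _≼•_ = Refl min a _≼_

  N : Fin n → Set
  N = Nbhd _≼_ a

  nbhd⇒covers : {b : Fin n} → N b → Covers _≼_ a b
  nbhd⇒covers (inj₁ a⋖b)               = a⋖b
  nbhd⇒covers (inj₂ ((b≼a , b≢a) , _)) = ⊥-elim (b≢a (a-min _ b≼a))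

  nbhd⇒≼ : {b : Fin n} → N b → a ≼ b
  nbhd⇒≼ = proj₁ ∘ proj₁ ∘ nbhd⇒covers

  nbhd⇒≢ : {b : Fin n} → N b → b ≢ a
  nbhd⇒≢ b∈N b≡a = proj₂ (proj₁ (nbhd⇒covers b∈N)) (sym b≡a)

  nbhd-antichain : {b c : Fin n} → N b → N c → b ≼ c → b ≡ c
  nbhd-antichain {b} {c} b∈N c∈N b≼c with b ≟ c
  ... | yes b≡c = b≡c
  ... | no b≢c  = ⊥-elim (proj₂ (nbhd⇒covers c∈N) (b , proj₁ (nbhd⇒covers b∈N) , (b≼c , b≢c)))

  -- A minimal element of the interval (a, l] covers a.
  nbhd-below : {l : Fin n} → a ≼ l → l ≢ a → ∃[ b ] (N b × b ≼ l)
  nbhd-below {l} a≼l l≢a = go l (po-wellFounded isPartialOrder l) (a≼l , l≢a ∘ sym)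
    where
    go : ∀ l → Acc (Lt _≼_) l → Lt _≼_ a l → ∃[ b ] (N b × b ≼ l)
    go l (acc below) a<l with any? (λ c → lt? I a c ×-dec lt? I c l)
    ... | yes (c , a<c , c<l) =
      let (b , b∈N , b≼c) = go c (below c<l) a<c in b , b∈N , ≼-trans b≼c (proj₁ c<l)
    ... | no nothing-between = l , inj₁ (a<l , nothing-between) , ≼-refl

  •-maximal : IsMaximal _≼•_ a
  •-maximal b ε                                  = refl
  •-maximal b (inj₁ (a∈N , _ , _) ◅ _)           = ⊥-elim (nbhd-irrefl {R = _≼_} a∈N)
  •-maximal b (inj₂ (a≢a , _ , _) ◅ _)           = ⊥-elim (a≢a refl)

  ≼•⇒≼ : {c d : Fin n} → c ≢ a → d ≢ a → c ≼• d → c ≼ d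
  ≼•⇒≼ c≢a d≢a ε                               = ≼-refl
  ≼•⇒≼ c≢a d≢a (inj₁ (_ , refl , _) ◅ a≼•d)    = ⊥-elim (d≢a (•-maximal _ a≼•d))
  ≼•⇒≼ c≢a d≢a (inj₂ (_ , e≢a , c≼e) ◅ e≼•d)   = ≼-trans c≼e (≼•⇒≼ e≢a d≢a e≼•d)

  ≼⇒≼• : {c d : Fin n} → c ≢ a → d ≢ a → c ≼ d → c ≼• d
  ≼⇒≼• c≢a d≢a c≼d = inj₂ (c≢a , d≢a , c≼d) ◅ ε

  ≼•a⇒≼nbhd : {c : Fin n} → c ≢ a → c ≼• a → ∃[ b ] (N b × c ≼ b)
  ≼•a⇒≼nbhd c≢a ε                                = ⊥-elim (c≢a refl)
  ≼•a⇒≼nbhd c≢a (inj₁ (c∈N , _ , _) ◅ _)         = _ , c∈N , ≼-refl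
  ≼•a⇒≼nbhd c≢a (inj₂ (_ , e≢a , c≼e) ◅ e≼•a)    =
    let (b , b∈N , e≼b) = ≼•a⇒≼nbhd e≢a e≼•a in b , b∈N , ≼-trans c≼e e≼b

  ≼nbhd⇒≼•a : {b c : Fin n} → c ≢ a → N b → c ≼ b → c ≼• a
  ≼nbhd⇒≼•a c≢a b∈N c≼b = inj₂ (c≢a , nbhd⇒≢ b∈N , c≼b) ◅ inj₁ (b∈N , refl , nbhd⇒≼ b∈N) ◅ ε

  nbhd⇒nbhd• : {b : Fin n} → N b → Nbhd _≼•_ a b
  nbhd⇒nbhd• {b} b∈N = inj₂ ((≼nbhd⇒≼•a (nbhd⇒≢ b∈N) b∈N ≼-refl , nbhd⇒≢ b∈N) , nothing-between)
    where
    nothing-between : ¬ (∃[ c ] (Lt _≼•_ b c × Lt _≼•_ c a))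
    nothing-between (c , (b≼•c , b≢c) , (c≼•a , c≢a)) =
      let b≼c = ≼•⇒≼ (nbhd⇒≢ b∈N) c≢a b≼•c
          (b′ , b′∈N , c≼b′) = ≼•a⇒≼nbhd c≢a c≼•a
          b≡b′ = nbhd-antichain b∈N b′∈N (≼-trans b≼c c≼b′)
      in b≢c (antisym b≼c (subst (c ≼_) (sym b≡b′) c≼b′))

  nbhd•⇒nbhd : {b : Fin n} → Nbhd _≼•_ a b → N b
  nbhd•⇒nbhd (inj₁ ((a≼•b , a≢b) , _))                = ⊥-elim (a≢b (sym (•-maximal _ a≼•b)))
  nbhd•⇒nbhd {b} (inj₂ ((b≼•a , b≢a) , nothing-between)) with ≼•a⇒≼nbhd b≢a b≼•a
  ... | b′ , b′∈N , b≼b′ with b ≟ b′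
  ...   | yes b≡b′ = subst N (sym b≡b′) b′∈N
  ...   | no b≢b′  = ⊥-elim (nothing-between
                       (b′ , (≼⇒≼• b≢a (nbhd⇒≢ b′∈N) b≼b′ , b≢b′) ,
                             (≼nbhd⇒≼•a (nbhd⇒≢ b′∈N) b′∈N ≼-refl , nbhd⇒≢ b′∈N)))

  reflect-involutive : (i j : Fin n) → Refl max a _≼•_ i j ⇔ i ≼ j
  reflect-involutive i j = mk⇔ to from
    where
    to : ∀ {i j} → Refl max a _≼•_ i j → i ≼ j
    to ε                                       = ≼-refl
    to (inj₁ (refl , b∈N• , _) ◅ b≼j)          = ≼-trans (nbhd⇒≼ (nbhd•⇒nbhd b∈N•)) (to b≼j)
    to (inj₂ (i≢a , e≢a , i≼•e) ◅ e≼j)         = ≼-trans (≼•⇒≼ i≢a e≢a i≼•e) (to e≼j)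
    from : ∀ {i j} → i ≼ j → Refl max a _≼•_ i j
    from {i} {j} i≼j with i ≟ a | j ≟ a
    ... | yes refl | yes refl = ε
    ... | no i≢a   | yes refl = ⊥-elim (i≢a (a-min i i≼j))
    ... | no i≢a   | no j≢a   = inj₂ (i≢a , j≢a , ≼⇒≼• i≢a j≢a i≼j) ◅ ε
    ... | yes refl | no j≢a   =
      let (b , b∈N , b≼j) = nbhd-below i≼j j≢a
      in inj₁ (refl , nbhd⇒nbhd• b∈N , inj₁ (b∈N , refl , nbhd⇒≼ b∈N) ◅ ε)
         ◅ inj₂ (nbhd⇒≢ b∈N , j≢a , ≼⇒≼• (nbhd⇒≢ b∈N) j≢a b≼j) ◅ ε

GramIdentity : (I : FinPoset n) (a : Fin n) {R : Rel (Fin n) 0ℓ} → Decidable R → Set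
GramIdentity I a d = ∀ k l → incMat (FinPoset._≼?_ I) k l ≡ bf (incMat d) (sMatrix I a k) (sMatrix I a l)

module MinimalGram
  (I : FinPoset n) (a : Fin n) (a-min : IsMinimal (FinPoset._≼_ I) a)
  (jf : JunctionFree min (FinPoset._≼_ I) a)
  (jf• : JunctionFree max (Refl min a (FinPoset._≼_ I)) a)
  (d• : Decidable (Refl min a (FinPoset._≼_ I)))
  where
  open FinPoset I
  open IsPartialOrder isPartialOrder using () renaming (refl to ≼-refl; trans to ≼-trans)
  open MinimalReflection I a a-min

  private
    C : Matrix n
    C = incMat d•

    M : Matrix n
    M = sMatrix I a

    χN : Fin n → ℤ
    χN i = ind (nbhd? I a i)

  -- Junction freeness of I: at most one neighbour of a lies below l.
  nbhds-below : {l : Fin n} → l ≢ a → ∑ (λ i → χN i * C i l) ≡ ind (a ≼? l)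
  nbhds-below {l} l≢a = ∑-ind-× (nbhd? I a) (λ i → d• i l) (a ≼? l) unique (mk⇔ to from)
    where
    unique : ∀ {b c} → N b × b ≼• l → N c × c ≼• l → b ≡ c
    unique (b∈N , b≼•l) (c∈N , c≼•l) =
      jf _ _ l b∈N c∈N l≢a (nbhd⇒≼ b∈N) (≼•⇒≼ (nbhd⇒≢ b∈N) l≢a b≼•l)
                           (nbhd⇒≼ c∈N) (≼•⇒≼ (nbhd⇒≢ c∈N) l≢a c≼•l)
    to : a ≼ l → ∃[ b ] (N b × b ≼• l)
    to a≼l = let (b , b∈N , b≼l) = nbhd-below a≼l l≢a in b , b∈N , ≼⇒≼• (nbhd⇒≢ b∈N) l≢a b≼l
    from : ∃[ b ] (N b × b ≼• l) → a ≼ l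
    from (b , b∈N , b≼•l) = ≼-trans (nbhd⇒≼ b∈N) (≼•⇒≼ (nbhd⇒≢ b∈N) l≢a b≼•l)

  -- Junction freeness of S_a I: at most one neighbour of a lies above k.
  nbhds-above : {k : Fin n} → k ≢ a → ∑ (λ j → χN j * C k j) ≡ C k a
  nbhds-above {k} k≢a = ∑-ind-× (nbhd? I a) (d• k) (d• k a) unique (mk⇔ to from)
    where
    nbhd≼•a : ∀ {b} → N b → b ≼• a
    nbhd≼•a b∈N = ≼nbhd⇒≼•a (nbhd⇒≢ b∈N) b∈N ≼-refl
    unique : ∀ {b c} → N b × k ≼• b → N c × k ≼• c → b ≡ c
    unique (b∈N , k≼•b) (c∈N , k≼•c) =
      jf• _ _ k (nbhd⇒nbhd• b∈N) (nbhd⇒nbhd• c∈N) k≢a k≼•b (nbhd≼•a b∈N) k≼•c (nbhd≼•a c∈N)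
    to : k ≼• a → ∃[ b ] (N b × k ≼• b)
    to k≼•a = let (b , b∈N , k≼b) = ≼•a⇒≼nbhd k≢a k≼•a in b , b∈N , ≼⇒≼• k≢a (nbhd⇒≢ b∈N) k≼b
    from : ∃[ b ] (N b × k ≼• b) → k ≼• a
    from (b , b∈N , k≼•b) = k≼•b ◅◅ nbhd≼•a b∈N

  nbhds-above-a : ∑ (λ j → χN j * C a j) ≡ 0ℤ
  nbhds-above-a = ∑-zero λ j →
    trans (ind-× (nbhd? I a j) (d• a j))
          (ind-no (nbhd? I a j ×-dec d• a j) (λ (j∈N , a≼•j) → nbhd⇒≢ j∈N (•-maximal j a≼•j)))

  C-sMatrix-a : (i : Fin n) → ∑ (λ j → C i j * M a j) ≡ - C i a + ∑ (λ j → χN j * C i j)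
  C-sMatrix-a i = trans (∑-cong (λ j → *-comm (C i j) (M a j))) (∑-sMatrix-a I a (C i))

  C-sMatrix-a-≢ : {i : Fin n} → i ≢ a → ∑ (λ j → C i j * M a j) ≡ 0ℤ
  C-sMatrix-a-≢ {i} i≢a =
    trans (C-sMatrix-a i) (trans (cong (- C i a +_) (nbhds-above i≢a)) (+-inverseˡ (C i a)))

  C-sMatrix-a-a : ∑ (λ j → C a j * M a j) ≡ - 1ℤ
  C-sMatrix-a-a =
    trans (C-sMatrix-a a) (trans (cong₂ _+_ (cong -_ (ind-yes (d• a a) ε)) nbhds-above-a) (+-identityʳ _))

  gram-≢-≢ : {k l : Fin n} → k ≢ a → l ≢ a → incMat _≼?_ k l ≡ bf C (M k) (M l)
  gram-≢-≢ {k} {l} k≢a l≢a = begin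
    ind (k ≼? l)                ≡⟨ ind-cong (k ≼? l) (d• k l) (mk⇔ (≼⇒≼• k≢a l≢a) (≼•⇒≼ k≢a l≢a)) ⟩
    C k l                       ≡⟨ bf-basis C k l ⟨
    bf C (idMat k) (idMat l)    ≡⟨ bf-cong C (sMatrix-≢ I a k≢a) (sMatrix-≢ I a l≢a) ⟨
    bf C (M k) (M l)            ∎
    where open ≡-Reasoning

  gram-a-≢ : {l : Fin n} → l ≢ a → incMat _≼?_ a l ≡ bf C (M a) (M l)
  gram-a-≢ {l} l≢a = begin
    ind (a ≼? l)                                ≡⟨ nbhds-below l≢a ⟨
    ∑ (λ i → χN i * C i l)                      ≡⟨ +-identityˡ _ ⟨
    0ℤ + ∑ (λ i → χN i * C i l)                 ≡⟨ cong (_+ ∑ (λ i → χN i * C i l)) (cong -_ a⋠•l) ⟨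
    - C a l + ∑ (λ i → χN i * C i l)            ≡⟨ ∑-sMatrix-a I a (λ i → C i l) ⟨
    ∑ (λ i → M a i * C i l)                     ≡⟨ bf-basisʳ C (M a) l ⟨
    bf C (M a) (idMat l)                        ≡⟨ bf-cong C {x = M a} (λ _ → refl) (sMatrix-≢ I a l≢a) ⟨
    bf C (M a) (M l)                            ∎
    where
    open ≡-Reasoning
    a⋠•l : C a l ≡ 0ℤ
    a⋠•l = ind-no (d• a l) (λ a≼•l → l≢a (•-maximal l a≼•l))

  gram-≢-a : {k : Fin n} → k ≢ a → incMat _≼?_ k a ≡ bf C (M k) (M a)
  gram-≢-a {k} k≢a = begin
    ind (k ≼? a)                  ≡⟨ ind-no (k ≼? a) (λ k≼a → k≢a (a-min k k≼a)) ⟩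
    0ℤ                            ≡⟨ C-sMatrix-a-≢ k≢a ⟨
    ∑ (λ j → C k j * M a j)       ≡⟨ bf-basisˡ C k (M a) ⟨
    bf C (idMat k) (M a)          ≡⟨ bf-cong C {y = M a} (sMatrix-≢ I a k≢a) (λ _ → refl) ⟨
    bf C (M k) (M a)              ∎
    where open ≡-Reasoning

  gram-a-a : incMat _≼?_ a a ≡ bf C (M a) (M a)
  gram-a-a = sym (begin
    bf C (M a) (M a)                 ≡⟨ bf-rows C (M a) (M a) ⟩
    ∑ (λ i → M a i * v i)            ≡⟨ ∑-sMatrix-a I a v ⟩
    - v a + ∑ (λ i → χN i * v i)     ≡⟨ cong₂ _+_ (cong -_ C-sMatrix-a-a) (∑-zero χN*v≡0) ⟩
    1ℤ                               ≡⟨ ind-yes (a ≼? a) ≼-refl ⟨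
    ind (a ≼? a)                     ∎)
    where
    open ≡-Reasoning
    v : Fin n → ℤ
    v i = ∑ (λ j → C i j * M a j)
    χN*v≡0 : ∀ i → χN i * v i ≡ 0ℤ
    χN*v≡0 i with toSum (i ≟ a)
    ... | inj₁ refl = trans (cong (_* v a) (ind-no (nbhd? I a a) (nbhd-irrefl {R = _≼_}))) (*-zeroˡ (v a))
    ... | inj₂ i≢a  = trans (cong (χN i *_) (C-sMatrix-a-≢ i≢a)) (*-zeroʳ (χN i))

  gram : GramIdentity I a d•
  gram k l with toSum (k ≟ a) | toSum (l ≟ a)
  ... | inj₁ refl | inj₁ refl = gram-a-a
  ... | inj₁ refl | inj₂ l≢a  = gram-a-≢ l≢a
  ... | inj₂ k≢a  | inj₁ refl = gram-≢-a k≢a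
  ... | inj₂ k≢a  | inj₂ l≢a  = gram-≢-≢ k≢a l≢a

module _ (I : FinPoset n) (a : Fin n) {R : Rel (Fin n) 0ℓ} (d : Decidable R) (gram : GramIdentity I a d) where
  open FinPoset I

  private
    M : Matrix n
    M = sMatrix I a

  sMap-preserves-bform : (x y : Fin n → ℤ) → bform _≼?_ x y ≡ bform d (sMap I a x) (sMap I a y)
  sMap-preserves-bform x y = begin
    bform _≼?_ x y                   ≡⟨ bf-*ᵥ (incMat d) M (incMat _≼?_) gram x y ⟩
    bf (incMat d) (x *ᵥ M) (y *ᵥ M)  ≡⟨ bf-cong (incMat d) (sMap-*ᵥ I a x) (sMap-*ᵥ I a y) ⟨
    bform d (sMap I a x) (sMap I a y) ∎
    where open ≡-Reasoning

  stronglyGramCongruent : StronglyGramCongruent (incMat _≼?_) (incMat d)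
  stronglyGramCongruent =
    transpose M , (transpose M , sMatrixᵀ-involutive I a , sMatrixᵀ-involutive I a) , congruence
    where
    open ≡-Reasoning
    congruence : (transpose (transpose M) ⊗ (incMat _≼?_ ⊗ transpose M)) ≐ incMat d
    congruence i j = begin
      ∑ (λ k → M i k * ∑ (λ l → incMat _≼?_ k l * M j l))  ≡⟨ bf-rows (incMat _≼?_) (M i) (M j) ⟨
      bform _≼?_ (M i) (M j)                              ≡⟨ sMap-preserves-bform (M i) (M j) ⟩
      bform d (sMap I a (M i)) (sMap I a (M j))           ≡⟨ bf-cong (incMat d) (sMap-involutive I a (idMat i))
                                                                                (sMap-involutive I a (idMat j)) ⟩
      bform d (idMat i) (idMat j)                         ≡⟨ bf-basis (incMat d) i j ⟩
      incMat d i j                                        ∎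

-- A maximal element of I is a minimal element of the opposite poset, and S_a commutes with
-- passing to the opposite.
module _ (I : FinPoset n) (a : Fin n) where
  open FinPoset I

  private
    max⇒flip-min : Refl max a _≼_ ⇒ flip (Refl min a (flip _≼_))
    max⇒flip-min = Equivalence.to refl-max⇔refl-min-flip
    flip-min⇒max : flip (Refl min a (flip _≼_)) ⇒ Refl max a _≼_
    flip-min⇒max = Equivalence.from refl-max⇔refl-min-flip

  gram-identity : (side : Side) → Extremal side _≼_ a → JunctionFree side _≼_ a →
                  JunctionFree (flipSide side) (Refl side a _≼_) a →
                  (d : Decidable (Refl side a _≼_)) → GramIdentity I a d
  gram-identity min a-min jf jf• d = MinimalGram.gram I a a-min jf jf• d
  gram-identity max a-max jf jf• d k l = begin
    incMat _≼?_ k l                                ≡⟨ MinimalGram.gram (opposite I) a a-max jf′ jf•′ d′ l k ⟩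
    bf (transpose (incMat d)) (M′ l) (M′ k)        ≡⟨ bf-transpose (incMat d) (M′ l) (M′ k) ⟩
    bf (incMat d) (M′ k) (M′ l)                    ≡⟨ bf-cong (incMat d) (sMap-opposite I a (idMat k))
                                                                         (sMap-opposite I a (idMat l)) ⟩
    bf (incMat d) (sMatrix I a k) (sMatrix I a l)  ∎
    where
    open ≡-Reasoning
    M′ : Matrix n
    M′ = sMatrix (opposite I) a
    jf′ : JunctionFree min (flip _≼_) a
    jf′ = junctionFree-flip max jf
    jf•′ : JunctionFree max (Refl min a (flip _≼_)) a
    jf•′ = junctionFree-resp max max⇒flip-min flip-min⇒max (junctionFree-flip min jf•)
    d′ : Decidable (Refl min a (flip _≼_))
    d′ x y = map′ max⇒flip-min flip-min⇒max (d y x)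

  reflect-involutive : (side : Side) → Extremal side _≼_ a →
                       ∀ i j → Refl (flipSide side) a (Refl side a _≼_) i j ⇔ i ≼ j
  reflect-involutive min a-min = MinimalReflection.reflect-involutive I a a-min
  reflect-involutive max a-max i j =
    ⇔-trans (mk⇔ (refl-resp min a max⇒flip-min flip-min⇒max) (refl-resp min a flip-min⇒max max⇒flip-min))
    (⇔-trans (⇔-sym refl-max⇔refl-min-flip)
             (MinimalReflection.reflect-involutive (opposite I) a a-max j i))

proposition3p5 : ∀ {n} (I : FinPoset n) (side : Side) (a : Fin n)
    → Extremal side (FinPoset._≼_ I) a
    → JunctionFree side (FinPoset._≼_ I) a
    → JunctionFree (flipSide side) (Refl side a (FinPoset._≼_ I)) a
    → (d : Decidable (Refl side a (FinPoset._≼_ I)))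
    → ((x y : Fin n → ℤ) → bform (FinPoset._≼?_ I) x y ≡ bform d (sMap I a x) (sMap I a y))
      × StronglyGramCongruent (incMat (FinPoset._≼?_ I)) (incMat d)
      × (∀ i j → Refl (flipSide side) a (Refl side a (FinPoset._≼_ I)) i j ⇔ FinPoset._≼_ I i j)
proposition3p5 I side a a-extremal jf jf• d =
  sMap-preserves-bform I a d gram , stronglyGramCongruent I a d gram , reflect-involutive I a side a-extremal
  where
  gram : GramIdentity I a d
  gram = gram-identity I a side a-extremal jf jf• d
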